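{- For the Power Dominating Set problem restricted to planar graphs, the algorithm described in the context, run on a tree decomposition of the input planar graph of width $O(\sqrt{n})$, achieves an approximation guarantee of $O(\sqrt{n})$, where $n$ is the number of nodes.
   Context: Power domination: for an undirected graph $G=(V,E)$ and $S\subseteq V$, $\mathcal{P}_S$ is obtained by (Rule 1) putting every node of $S$ and every neighbor of a node of $S$ into $\mathcal{P}_S$, and (Rule 2) repeatedly: if $v\in\mathcal{P}_S$ and all neighbors of $v$ except exactly one neighbor $w$ are in $\mathcal{P}_S$, insert $w$. $S$ power dominates $G$ if $\mathcal{P}_S=V$; the PDS problem asks for a minimum-size such $S$. For $R\subseteq V$, $nbr(R)=\{v\in V\setminus R: v$ adjacent to some $u\in R\}$; $R$ is an $S$-strong region if $R\not\subseteq\mathcal{P}_{S\cup nbr(R)}$. A tree decomposition of $G$ is a pair $\langle\{X_i: i\in I\},T\rangle$ where $T$ is a tree on node set $I$, each $X_i\subseteq V$ (a bag), $\bigcup_i X_i=V$, every edge has both ends in some bag, and whenever $j$ lies on the path from $i$ to $k$ in $T$ we have $X_i\cap X_k\subseteq X_j$; its width is $\max_i|X_i|-1$. It is known that an $n$-node planar graph has a tree decomposition of width $O(\sqrt n)$ computable in $O(n^{3/2})$ time. Algorithm: root $T$ at $r$; let $d$ be the maximum distance from $r$ in $T$. Set $S=\emptyset$. For $\ell=d,\dots,0$ and each $T$-node $q$ at distance $\ell$ from $r$: let $Y_q$ be the union of the bags in the subtree rooted at $q$; if $Y_q$ is an $S$-strong region, set $S\leftarrow S\cup X_q$. Output $S$.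 -}

module Defs where

open import Data.Nat using (ℕ; zero; suc; _≤_; _*_; _∸_; _<ᵇ_)
open import Data.Fin using (Fin; toℕ)
open import Data.Fin.Subset using (Subset; _∈_; _∉_; _∪_; ∣_∣; ⊥)
open import Data.Bool using (Bool)
open import Data.List using (List; []; _∷_; allFin)
open import Data.List.Relation.Unary.Unique.Propositional using (Unique)
open import Data.List.Relation.Binary.Permutation.Propositional using (_↭_)
open import Data.List.Membership.Propositional renaming (_∈_ to _∈ₗ_)
open import Data.Maybe using (Maybe; just)
open import Data.Product using (_×_; Σ; ∃; ∃-syntax; _,_)
open import Data.Sum using (_⊎_)
open import Relation.Nullary using (¬_)
open import Relation.Binary using (Decidable)
open import Relation.Binary.PropositionalEquality using (_≡_; _≢_)

record Graph (n : ℕ) : Set₁ where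
  field
    Adj    : Fin n → Fin n → Set
    adj?   : Decidable Adj
    sym    : ∀ {u v} → Adj u v → Adj v u
    irrefl : ∀ {u} → ¬ Adj u u
open Graph public

-- Planarity (Wagner): no K5 minor and no K3,3 minor.

data ReachIn {n : ℕ} (G : Graph n) (P : Fin n → Set) : Fin n → Fin n → Set where
  here : ∀ {u} → P u → ReachIn G P u u
  step : ∀ {u v w} → P u → Adj G u v → ReachIn G P v w → ReachIn G P u w

-- H (given by its adjacency relation on Fin h) is a minor of G:
-- branch sets β⁻¹(a) are pairwise disjoint (β is a function), nonempty,
-- connected in G, and adjacent branch sets are joined by an edge of G.
record Minor {h n : ℕ} (AdjH : Fin h → Fin h → Set) (G : Graph n) : Set where
  field
    β         : Fin n → Maybe (Fin h)
    nonempty  : ∀ a → ∃[ v ] (β v ≡ just a)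
    connected : ∀ a u v → β u ≡ just a → β v ≡ just a →
                ReachIn G (λ x → β x ≡ just a) u v
    edges     : ∀ a b → AdjH a b →
                ∃[ u ] ∃[ v ] (β u ≡ just a × β v ≡ just b × Adj G u v)

K₅-Adj : Fin 5 → Fin 5 → Set
K₅-Adj i j = i ≢ j

side : Fin 6 → Bool
side i = toℕ i <ᵇ 3

K₃₃-Adj : Fin 6 → Fin 6 → Set
K₃₃-Adj i j = side i ≢ side j

Planar : {n : ℕ} → Graph n → Set
Planar G = ¬ Minor K₅-Adj G × ¬ Minor K₃₃-Adj G

data 𝒫 {n : ℕ} (G : Graph n) (S : Fin n → Set) : Fin n → Set where
  rule1-self : ∀ {v} → S v → 𝒫 G S v
  rule1-nbr  : ∀ {v w} → S v → Adj G v w → 𝒫 G S w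
  rule2      : ∀ {v w} → 𝒫 G S v → Adj G v w →
               (∀ u → Adj G v u → u ≢ w → 𝒫 G S u) → 𝒫 G S w

PowerDominates : {n : ℕ} → Graph n → Subset n → Set
PowerDominates G S = ∀ v → 𝒫 G (_∈ S) v

nbr : {n : ℕ} → Graph n → (Fin n → Set) → Fin n → Set
nbr G R v = ¬ R v × ∃[ u ] (R u × Adj G u v)

_∪ₚ_ : {n : ℕ} → (Fin n → Set) → (Fin n → Set) → Fin n → Set
(A ∪ₚ B) v = A v ⊎ B v

StrongRegion : {n : ℕ} → Graph n → Subset n → (Fin n → Set) → Set
StrongRegion G S R = ¬ (∀ v → R v → 𝒫 G ((_∈ S) ∪ₚ nbr G R) v)

-- Rooted trees on Fin m (an arbitrary tree T together with a root r,
-- given by parent pointers and depths = distance from r in T)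

record RootedTree (m : ℕ) : Set where
  field
    root       : Fin m
    parent     : Fin m → Fin m
    depth      : Fin m → ℕ
    depth-root : depth root ≡ 0
    depth-zero : ∀ q → depth q ≡ 0 → q ≡ root
    depth-par  : ∀ q → q ≢ root → depth q ≡ suc (depth (parent q))
open RootedTree public

TAdj : {m : ℕ} → RootedTree m → Fin m → Fin m → Set
TAdj T a b = (a ≢ root T × parent T a ≡ b) ⊎ (b ≢ root T × parent T b ≡ a)

data TWalk {m : ℕ} (T : RootedTree m) : Fin m → Fin m → List (Fin m) → Set where
  stop : ∀ {i} → TWalk T i i (i ∷ [])
  go   : ∀ {i j k ns} → TAdj T i j → TWalk T j k ns → TWalk T i k (i ∷ ns)

OnPath : {m : ℕ} → RootedTree m → Fin m → Fin m → Fin m → Set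
OnPath T i j k = ∃[ ns ] (TWalk T i k ns × Unique ns × j ∈ₗ ns)

data Desc {m : ℕ} (T : RootedTree m) (q : Fin m) : Fin m → Set where
  self : Desc T q q
  down : ∀ {q'} → q' ≢ root T → Desc T q (parent T q') → Desc T q q'

record TreeDecomposition {n : ℕ} (G : Graph n) (m : ℕ) : Set where
  field
    tree     : RootedTree m
    bag      : Fin m → Subset n
    covers   : ∀ v → ∃[ i ] (v ∈ bag i)
    edgeIn   : ∀ u v → Adj G u v → ∃[ i ] (u ∈ bag i × v ∈ bag i)
    coherent : ∀ i j k → OnPath tree i j k →
               ∀ v → v ∈ bag i → v ∈ bag k → v ∈ bag j
open TreeDecomposition public

Y : {n m : ℕ} {G : Graph n} → TreeDecomposition G m → Fin m → Fin n → Set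
Y D q v = ∃[ q' ] (Desc (tree D) q q' × v ∈ bag D q')

WidthSqBound : {n m : ℕ} {G : Graph n} → TreeDecomposition G m → ℕ → ℕ → Set
WidthSqBound D c n = ∀ i → (∣ bag D i ∣ ∸ 1) * (∣ bag D i ∣ ∸ 1) ≤ c * c * n

record ProcessingOrder {n m : ℕ} {G : Graph n} (D : TreeDecomposition G m) : Set where
  field
    nodes   : List (Fin m)
    perm    : nodes ↭ allFin m
    ordered : ∀ xs q q' ys → nodes ≡ (xs Data.List.++ (q ∷ ys)) → q' ∈ₗ ys →
              depth (tree D) q' ≤ depth (tree D) q
open ProcessingOrder public

data Run {n m : ℕ} {G : Graph n} (D : TreeDecomposition G m) :
         List (Fin m) → Subset n → Subset n → Set where
  done : ∀ {S} → Run D [] S S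
  take : ∀ {q qs S S'} → StrongRegion G S (Y D q) →
         Run D qs (S ∪ bag D q) S' → Run D (q ∷ qs) S S'
  skip : ∀ {q qs S S'} → ¬ StrongRegion G S (Y D q) →
         Run D qs S S' → Run D (q ∷ qs) S S'

AlgOutput : {n m : ℕ} {G : Graph n} (D : TreeDecomposition G m) →
            ProcessingOrder D → Subset n → Set
AlgOutput D π S = Run D (nodes π) ⊥ S

-- Call a T-node q resolved for S when S ∪ nbr(Y_q) observes all of Y_q, i.e. when Y_q is not
-- S-strong.  The border of Y_q lies in X_q ∩ X_parent(q), so once all children of q are resolved,
-- adding X_q observes Y_q outright; as children are processed before parents, every node ends up
-- resolved and S power dominates G (Y_root = V).
-- For the size, let W be the union of the Y_t of the nodes t taken so far: W is observed by S and
-- its border lies in S.  If Y_q is S-strong, an optimal solution S* must have a vertex in Y_q ∖ W,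
-- for otherwise everything S* observes in Y_q is already observed by S ∪ nbr(Y_q).  Charging X_q
-- to that vertex gives |S| ≤ (max bag size) · |S*|, i.e. |S|² ≤ (2c+1)² n |S*|².

module Submission where

open import Defs
open import Data.Nat using (ℕ; zero; suc; _+_; _*_; _∸_; _≤_; _<_; z≤n; s≤s)
open import Data.Nat.Properties
  using ( ≤-refl; ≤-trans; <-≤-trans; <⇒≱; 1+n≰n; n≤1+n; m≤m+n; suc-injective
        ; +-comm; +-suc; *-suc; +-mono-≤; +-monoʳ-≤; *-mono-≤; *-monoʳ-≤; *-monoˡ-≤; module ≤-Reasoning)
open import Data.Nat.Tactic.RingSolver using (solve-∀)
open import Data.Fin using (Fin; _≟_)
open import Data.Fin.Properties using (any?; all?)
open import Data.Fin.Subset using (Subset; _∈_; _∉_; _⊆_; _∪_; ∣_∣; ⊥; ⁅_⁆; inside; outside)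
open import Data.Fin.Subset.Properties
  using ( _∈?_; ∉⊥; ∣⊥∣≡0; ∣p∣≤n; x∈⁅x⁆; x∈⁅y⁆⇒x≡y; p⊆p∪q; q⊆p∪q; x∈p∪q⁻; x∈p∪q⁺
        ; p⊂q⇒∣p∣<∣q∣; p⊆q⇒∣p∣≤∣q∣)
open import Data.Vec using ([]; _∷_)
open import Data.List using (List; []; _∷_; _++_; tabulate)
open import Data.List.Properties using (++-assoc; ++-identityʳ)
open import Data.List.Extrema.Nat using (max; argmax-all; xs≤max)
open import Data.List.Relation.Unary.Any using (Any; here; there)
import Data.List.Relation.Unary.Any as Any
open import Data.List.Relation.Unary.All using (All; []; _∷_)
import Data.List.Relation.Unary.All as All
open import Data.List.Relation.Unary.All.Properties using (++⁺; tabulate⁺; tabulate⁻; ¬Any⇒All¬)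
open import Data.List.Relation.Unary.Unique.Propositional using (Unique)
open import Data.List.Relation.Unary.AllPairs using ([]; _∷_)
open import Data.List.Membership.Propositional using () renaming (_∈_ to _∈ₗ_)
open import Data.List.Membership.Propositional.Properties using (∈-++⁻; ∈-allFin)
import Data.List.Membership.DecPropositional as DecMembership
open import Data.List.Relation.Binary.Permutation.Propositional using (↭-sym)
open import Data.List.Relation.Binary.Permutation.Propositional.Properties using (∈-resp-↭)
open import Data.Product using (_×_; ∃-syntax; _,_; proj₁; proj₂)
import Data.Product as Product
open import Data.Sum using (_⊎_; inj₁; inj₂; [_,_]′)
open import Data.Empty using (⊥-elim)
open import Function using (_∘_; id)
open import Relation.Nullary using (¬_; Dec; yes; no)
open import Relation.Nullary.Decidable using (_×-dec_; _⊎-dec_; _→-dec_; ¬?; map′; decidable-stable)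
open import Relation.Unary using () renaming (_⊆_ to _⊆ₚ_; Decidable to Decidableₚ)
open import Relation.Binary.PropositionalEquality using (_≡_; _≢_; refl; trans; subst) renaming (sym to ≡-sym)

∣p∪q∣≤∣p∣+∣q∣ : ∀ {n} (p q : Subset n) → ∣ p ∪ q ∣ ≤ ∣ p ∣ + ∣ q ∣
∣p∪q∣≤∣p∣+∣q∣ []            []            = z≤n
∣p∪q∣≤∣p∣+∣q∣ (inside  ∷ p) (inside  ∷ q) =
  s≤s (≤-trans (∣p∪q∣≤∣p∣+∣q∣ p q) (+-monoʳ-≤ ∣ p ∣ (n≤1+n ∣ q ∣)))
∣p∪q∣≤∣p∣+∣q∣ (inside  ∷ p) (outside ∷ q) = s≤s (∣p∪q∣≤∣p∣+∣q∣ p q)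
∣p∪q∣≤∣p∣+∣q∣ (outside ∷ p) (inside  ∷ q) =
  subst (suc ∣ p ∪ q ∣ ≤_) (≡-sym (+-suc ∣ p ∣ ∣ q ∣)) (s≤s (∣p∪q∣≤∣p∣+∣q∣ p q))
∣p∪q∣≤∣p∣+∣q∣ (outside ∷ p) (outside ∷ q) = ∣p∪q∣≤∣p∣+∣q∣ p q

∣p∣<∣p∪⁅x⁆∣ : ∀ {n} {p : Subset n} {x} → x ∉ p → ∣ p ∣ < ∣ p ∪ ⁅ x ⁆ ∣
∣p∣<∣p∪⁅x⁆∣ {x = x} x∉p = p⊂q⇒∣p∣<∣q∣ (p⊆p∪q ⁅ x ⁆ , x , x∈p∪q⁺ (inj₂ (x∈⁅x⁆ x)) , x∉p)

y∈p∪⁅x⁆⁻ : ∀ {n} {p : Subset n} {x y} → y ∈ p ∪ ⁅ x ⁆ → y ∈ p ⊎ y ≡ x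
y∈p∪⁅x⁆⁻ {p = p} {x} y∈ with x∈p∪q⁻ p ⁅ x ⁆ y∈
... | inj₁ y∈p  = inj₁ y∈p
... | inj₂ y∈⁅x⁆ = inj₂ (x∈⁅y⁆⇒x≡y x y∈⁅x⁆)

-- For x ≥ 2 the factor 2 absorbs the ∸ 1, as x ≤ 2 (x ∸ 1); for x = 1 we need n ≥ 1.
bag-size-bound : ∀ c n x → x ≤ n → (x ∸ 1) * (x ∸ 1) ≤ c * c * n →
                 x * x ≤ suc (c + c) * suc (c + c) * n
bag-size-bound c n       zero          _ _ = z≤n
bag-size-bound c (suc n) (suc zero)    _ _ = s≤s z≤n
bag-size-bound c n       (suc (suc t)) _ w = begin
  suc (suc t) * suc (suc t)       ≤⟨ *-mono-≤ x≤2x-2 x≤2x-2 ⟩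
  (2 * suc t) * (2 * suc t)       ≡⟨ square-double (suc t) ⟩
  4 * (suc t * suc t)             ≤⟨ *-monoʳ-≤ 4 w ⟩
  4 * (c * c * n)                 ≡⟨ four-times c n ⟩
  (c + c) * (c + c) * n           ≤⟨ *-monoˡ-≤ n (*-mono-≤ (n≤1+n (c + c)) (n≤1+n (c + c))) ⟩
  suc (c + c) * suc (c + c) * n   ∎
  where
  open ≤-Reasoning
  square-double : ∀ a → (2 * a) * (2 * a) ≡ 4 * (a * a)
  square-double = solve-∀
  four-times : ∀ c n → 4 * (c * c * n) ≡ (c + c) * (c + c) * n
  four-times = solve-∀
  double-suc : ∀ t → suc (suc (t + t)) ≡ 2 * suc t
  double-suc = solve-∀
  x≤2x-2 : suc (suc t) ≤ 2 * suc t
  x≤2x-2 = subst (suc (suc t) ≤_) (double-suc t) (s≤s (s≤s (m≤m+n t t)))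

square-≤ : ∀ {a b s M} → a ≤ b * s → b * b ≤ M → a * a ≤ M * (s * s)
square-≤ {a} {b} {s} {M} a≤bs b²≤M = begin
  a * a               ≤⟨ *-mono-≤ a≤bs a≤bs ⟩
  (b * s) * (b * s)   ≡⟨ interchange b s ⟩
  (b * b) * (s * s)   ≤⟨ *-monoˡ-≤ (s * s) b²≤M ⟩
  M * (s * s)         ∎
  where
  open ≤-Reasoning
  interchange : ∀ b s → (b * s) * (b * s) ≡ (b * b) * (s * s)
  interchange = solve-∀

module _ {n : ℕ} (G : Graph n) where

  border : (Fin n → Set) → Fin n → Set
  border R u = R u × ∃[ w ] (Adj G u w × ¬ R w)

  nbr? : ∀ {R} → Decidableₚ R → Decidableₚ (nbr G R)
  nbr? R? v = ¬? (R? v) ×-dec any? (λ u → R? u ×-dec adj? G u v)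

  adj⇒R∪nbr : ∀ {R} → Decidableₚ R → ∀ {x u} → R x → Adj G x u → (R ∪ₚ nbr G R) u
  adj⇒R∪nbr R? {x} {u} Rx e with R? u
  ... | yes Ru = inj₁ Ru
  ... | no ¬Ru = inj₂ (¬Ru , x , Rx , e)

  𝒫-mono : ∀ {A B} → A ⊆ₚ B → 𝒫 G A ⊆ₚ 𝒫 G B
  𝒫-mono A⊆B (rule1-self a)  = rule1-self (A⊆B a)
  𝒫-mono A⊆B (rule1-nbr a e) = rule1-nbr (A⊆B a) e
  𝒫-mono A⊆B (rule2 p e h)   = rule2 (𝒫-mono A⊆B p) e (λ u a u≢w → 𝒫-mono A⊆B (h u a u≢w))

  module Saturation {A : Fin n → Set} (A? : Decidableₚ A) where

    Derivable : Subset n → Fin n → Set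
    Derivable P w = A w ⊎ (∃[ v ] (A v × Adj G v w))
                        ⊎ (∃[ v ] (v ∈ P × Adj G v w × (∀ u → Adj G v u → u ≢ w → u ∈ P)))

    derivable? : ∀ P → Decidableₚ (Derivable P)
    derivable? P w =
      A? w ⊎-dec any? (λ v → A? v ×-dec adj? G v w)
           ⊎-dec any? (λ v → (v ∈? P) ×-dec (adj? G v w ×-dec
                              all? (λ u → adj? G v u →-dec (¬? (u ≟ w) →-dec (u ∈? P)))))

    Sound Closed : Subset n → Set
    Sound  P = (_∈ P) ⊆ₚ 𝒫 G A
    Closed P = Derivable P ⊆ₚ (_∈ P)

    derivable-sound : ∀ {P} → Sound P → Derivable P ⊆ₚ 𝒫 G A
    derivable-sound sound (inj₁ a)                         = rule1-self a
    derivable-sound sound (inj₂ (inj₁ (_ , a , e)))        = rule1-nbr a e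
    derivable-sound sound (inj₂ (inj₂ (_ , v∈P , e , h))) = rule2 (sound v∈P) e (λ u a u≢w → sound (h u a u≢w))

    closed-complete : ∀ {P} → Closed P → 𝒫 G A ⊆ₚ (_∈ P)
    closed-complete closed (rule1-self a)  = closed (inj₁ a)
    closed-complete closed (rule1-nbr a e) = closed (inj₂ (inj₁ (_ , a , e)))
    closed-complete closed (rule2 p e h)   =
      closed (inj₂ (inj₂ (_ , closed-complete closed p , e , λ u a u≢w → closed-complete closed (h u a u≢w))))

    saturate : ∀ k P → n ≤ k + ∣ P ∣ → Sound P → ∃[ P′ ] (Sound P′ × Closed P′)
    saturate k P bound sound with any? (λ w → ¬? (w ∈? P) ×-dec derivable? P w)
    ... | no none = P , sound , λ {w} d → decidable-stable (w ∈? P) (λ w∉P → none (w , w∉P , d))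
    saturate zero P bound sound | yes (w , w∉P , d) =
      ⊥-elim (<⇒≱ (<-≤-trans (∣p∣<∣p∪⁅x⁆∣ w∉P) (∣p∣≤n (P ∪ ⁅ w ⁆))) bound)
    saturate (suc k) P bound sound | yes (w , w∉P , d) =
      saturate k (P ∪ ⁅ w ⁆) bound′ sound′
      where
      bound′ : n ≤ k + ∣ P ∪ ⁅ w ⁆ ∣
      bound′ = ≤-trans bound (subst (_≤ k + ∣ P ∪ ⁅ w ⁆ ∣) (+-suc k ∣ P ∣) (+-monoʳ-≤ k (∣p∣<∣p∪⁅x⁆∣ w∉P)))
      sound′ : Sound (P ∪ ⁅ w ⁆)
      sound′ v∈ with y∈p∪⁅x⁆⁻ v∈
      ... | inj₁ v∈P = sound v∈P
      ... | inj₂ refl = derivable-sound sound d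

    closure : ∃[ P ] (Sound P × Closed P)
    closure = saturate n ⊥ (subst (λ z → n ≤ n + z) (≡-sym (∣⊥∣≡0 n)) (m≤m+n n 0)) (⊥-elim ∘ ∉⊥)

  𝒫? : ∀ {A} → Decidableₚ A → Decidableₚ (𝒫 G A)
  𝒫? A? v = let (P , sound , closed) = closure in map′ sound (closed-complete closed) (v ∈? P)
    where open Saturation A?

  -- Within R ∪ nbr(R), observers placed on nbr(R) can be replaced by the border of R.
  module _ {R A B : Fin n → Set} (R? : Decidableₚ R) (A⊆B : A ⊆ₚ B) (border⊆B : border R ⊆ₚ B) where

    𝒫-elim-nbr : ∀ {v} → 𝒫 G (A ∪ₚ nbr G R) v → (R ∪ₚ nbr G R) v → 𝒫 G B v
    𝒫-elim-nbr {v} _ (inj₂ (¬Rv , u , Ru , e)) = rule1-nbr (border⊆B (Ru , v , e , ¬Rv)) e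
    𝒫-elim-nbr (rule1-self (inj₁ a))              (inj₁ _)  = rule1-self (A⊆B a)
    𝒫-elim-nbr (rule1-self (inj₂ (¬Rv , _)))      (inj₁ Rv) = ⊥-elim (¬Rv Rv)
    𝒫-elim-nbr (rule1-nbr (inj₁ a) e)             (inj₁ _)  = rule1-nbr (A⊆B a) e
    𝒫-elim-nbr (rule1-nbr {x} (inj₂ (¬Rx , _)) e) (inj₁ Rw) = rule1-self (border⊆B (Rw , x , sym G e , ¬Rx))
    𝒫-elim-nbr (rule2 {x} p e h)                  (inj₁ Rw) with R? x
    ... | yes Rx = rule2 (𝒫-elim-nbr p (inj₁ Rx)) e (λ u a u≢w → 𝒫-elim-nbr (h u a u≢w) (adj⇒R∪nbr R? Rx a))
    ... | no ¬Rx = rule1-self (border⊆B (Rw , x , sym G e , ¬Rx))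

  -- A derivation from A can only enter R ∖ W from the border of W or from nbr(R).
  module _ {R W A B : Fin n → Set} (R? : Decidableₚ R) (W? : Decidableₚ W)
           (W⊆𝒫 : W ⊆ₚ 𝒫 G B) (border⊆B : border W ⊆ₚ B) (A∩R⊆W : ∀ {v} → A v → R v → W v) where

    𝒫-transfer : ∀ {v} → 𝒫 G A v → (R ∪ₚ nbr G R) v → 𝒫 G (B ∪ₚ nbr G R) v
    𝒫-transfer _ (inj₂ nb) = rule1-self (inj₂ nb)
    𝒫-transfer {v} p (inj₁ Rv) with W? v
    ... | yes Wv = 𝒫-mono inj₁ (W⊆𝒫 Wv)
    𝒫-transfer (rule1-self a) (inj₁ Rv) | no ¬Wv = ⊥-elim (¬Wv (A∩R⊆W a Rv))
    𝒫-transfer (rule1-nbr {x} {w} a e) (inj₁ Rw) | no ¬Ww with R? x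
    ... | yes Rx = rule1-nbr (inj₁ (border⊆B (A∩R⊆W a Rx , w , e , ¬Ww))) e
    ... | no ¬Rx = rule1-nbr (inj₂ (¬Rx , w , Rw , sym G e)) e
    𝒫-transfer (rule2 {x} {w} p e h) (inj₁ Rw) | no ¬Ww with R? x
    ... | yes Rx = rule2 (𝒫-transfer p (inj₁ Rx)) e (λ u a u≢w → 𝒫-transfer (h u a u≢w) (adj⇒R∪nbr R? Rx a))
    ... | no ¬Rx = rule1-nbr (inj₂ (¬Rx , w , Rw , sym G e)) e

  strongRegion-meets-dominator :
    ∀ {S* S : Subset n} {R W : Fin n → Set} → Decidableₚ R → Decidableₚ W →
    PowerDominates G S* → W ⊆ₚ 𝒫 G (_∈ S) → border W ⊆ₚ (_∈ S) →
    StrongRegion G S R → ∃[ s ] (s ∈ S* × R s × ¬ W s)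
  strongRegion-meets-dominator {S*} {R = R} {W} R? W? dominates W⊆𝒫 border⊆S strong
    with any? (λ s → (s ∈? S*) ×-dec (R? s ×-dec ¬? (W? s)))
  ... | yes witness = witness
  ... | no none = ⊥-elim (strong λ v Rv → 𝒫-transfer R? W? W⊆𝒫 border⊆S S*∩R⊆W (dominates v) (inj₁ Rv))
    where
    S*∩R⊆W : ∀ {s} → s ∈ S* → R s → W s
    S*∩R⊆W {s} s∈S* Rs = decidable-stable (W? s) (λ ¬Ws → none (s , s∈S* , Rs , ¬Ws))

module _ {m : ℕ} (T : RootedTree m) where

  Child : Fin m → Fin m → Set
  Child c q = c ≢ root T × parent T c ≡ q

  parent-induction : (P : Fin m → Set) → P (root T) →
                     (∀ q → q ≢ root T → P (parent T q) → P q) → ∀ q → P q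
  parent-induction P base from-parent q = by-depth (depth T q) q refl
    where
    by-depth : ∀ k q → depth T q ≡ k → P q
    by-depth zero    q d≡0 = subst P (≡-sym (depth-zero T q d≡0)) base
    by-depth (suc k) q d≡k+1 with q ≟ root T
    ... | yes refl = base
    ... | no q≢r   = from-parent q q≢r (by-depth k (parent T q) parent-depth)
      where
      parent-depth : depth T (parent T q) ≡ k
      parent-depth = suc-injective (trans (≡-sym (depth-par T q q≢r)) d≡k+1)

  Desc-root : ∀ q → Desc T (root T) q
  Desc-root = parent-induction (Desc T (root T)) self (λ _ → down)

  Desc-inv : ∀ {d q} → Desc T d q → q ≡ d ⊎ (q ≢ root T × Desc T d (parent T q))
  Desc-inv self         = inj₁ refl
  Desc-inv (down q≢r p) = inj₂ (q≢r , p)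

  Desc? : ∀ d → Decidableₚ (Desc T d)
  Desc? d = parent-induction (Dec ∘ Desc T d) at-root via-parent
    where
    at-root : Dec (Desc T d (root T))
    at-root with root T ≟ d
    ... | yes r≡d = yes (subst (Desc T d) (≡-sym r≡d) self)
    ... | no r≢d  = no (λ p → [ r≢d , (λ (r≢r , _) → r≢r refl) ]′ (Desc-inv p))
    via-parent : ∀ q → q ≢ root T → Dec (Desc T d (parent T q)) → Dec (Desc T d q)
    via-parent q q≢r below with q ≟ d
    ... | yes refl = yes self
    ... | no q≢d   = map′ (down q≢r) (λ p → [ ⊥-elim ∘ q≢d , proj₂ ]′ (Desc-inv p)) below

  Desc-split : ∀ {q q′} → Desc T q q′ → q′ ≡ q ⊎ ∃[ c ] (Child c q × Desc T c q′)
  Desc-split self = inj₁ refl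
  Desc-split (down {q′} q′≢r p) with Desc-split p
  ... | inj₁ refl                 = inj₂ (q′ , (q′≢r , refl) , self)
  ... | inj₂ (c , c-child , c≤p) = inj₂ (c , c-child , down q′≢r c≤p)

  TWalk-head : ∀ {i k ns} → TWalk T i k ns → i ∈ₗ ns
  TWalk-head stop     = here refl
  TWalk-head (go _ _) = here refl

  TWalk-++ : ∀ {i j k ns ms} → TWalk T i j ns → TWalk T j k ms → ∃[ ls ] TWalk T i k ls
  TWalk-++ stop     w = _ , w
  TWalk-++ (go e v) w = _ , go e (proj₂ (TWalk-++ v w))

  walk-to-root : ∀ q → ∃[ ns ] TWalk T q (root T) ns
  walk-to-root = parent-induction _ (_ , stop) (λ q q≢r w → _ , go (inj₁ (q≢r , refl)) (proj₂ w))

  walk-from-root : ∀ q → ∃[ ns ] TWalk T (root T) q ns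
  walk-from-root = parent-induction _ (_ , stop) (λ q q≢r w → TWalk-++ (proj₂ w) (go (inj₂ (q≢r , refl)) stop))

  TWalk-suffix : ∀ {i j k ms} → TWalk T j k ms → Unique ms → i ∈ₗ ms → ∃[ ls ] (TWalk T i k ls × Unique ls)
  TWalk-suffix stop     u       (here refl) = _ , stop , u
  TWalk-suffix (go e w) u       (here refl) = _ , go e w , u
  TWalk-suffix (go e w) (_ ∷ u) (there i∈)  = TWalk-suffix w u i∈

  loop-erase : ∀ {i k ns} → TWalk T i k ns → ∃[ ms ] (TWalk T i k ms × Unique ms)
  loop-erase stop = _ , stop , [] ∷ []
  loop-erase (go {i} e w) with loop-erase w
  ... | ms , w′ , u with DecMembership._∈?_ _≟_ i ms
  ...   | yes i∈ms = TWalk-suffix w′ u i∈ms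
  ...   | no  i∉ms = _ , go e w′ , ¬Any⇒All¬ ms i∉ms ∷ u

  path : ∀ i k → ∃[ ns ] (TWalk T i k ns × Unique ns)
  path i k = loop-erase (proj₂ (TWalk-++ (proj₂ (walk-to-root i)) (proj₂ (walk-from-root k))))

  TWalk-exit : ∀ {d x y ns} → TWalk T x y ns → Desc T d x → ¬ Desc T d y → d ∈ₗ ns × parent T d ∈ₗ ns
  TWalk-exit stop dx ¬dy = ⊥-elim (¬dy dx)
  TWalk-exit {d} (go {j = j} e w) dx ¬dy with Desc? d j
  ... | yes dj = Product.map there there (TWalk-exit w dj ¬dy)
  ... | no ¬dj with e | dx
  ...   | inj₂ (j≢r , refl) | _          = ⊥-elim (¬dj (down j≢r dx))
  ...   | inj₁ (_ , refl)   | self       = here refl , there (TWalk-head w)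
  ...   | inj₁ (_ , refl)   | down _ dp  = ⊥-elim (¬dj dp)

module _ {n m : ℕ} {G : Graph n} (D : TreeDecomposition G m) where

  Y? : ∀ q → Decidableₚ (Y D q)
  Y? q v = any? (λ q′ → Desc? (tree D) q q′ ×-dec (v ∈? bag D q′))

  Y-root : ∀ v → Y D (root (tree D)) v
  Y-root v = let (i , v∈Xᵢ) = covers D v in i , Desc-root (tree D) i , v∈Xᵢ

  border-Y⊆bags : ∀ d → border G (Y D d) ⊆ₚ (λ u → u ∈ bag D d × u ∈ bag D (parent (tree D) d))
  border-Y⊆bags d {u} ((q′ , d≤q′ , u∈X) , w , e , w∉Y) with edgeIn D u w e
  ... | b , u∈Xb , w∈Xb with path (tree D) q′ b
  ...   | ns , walk , unique with TWalk-exit (tree D) walk d≤q′ (λ d≤b → w∉Y (b , d≤b , w∈Xb))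
  ...     | d∈ns , pd∈ns = coherent D q′ d b (ns , walk , unique , d∈ns) u u∈X u∈Xb
                         , coherent D q′ (parent (tree D) d) b (ns , walk , unique , pd∈ns) u u∈X u∈Xb

  maxBagSize : ℕ
  maxBagSize = max 0 (tabulate (λ q → ∣ bag D q ∣))

  bag≤maxBagSize : ∀ q → ∣ bag D q ∣ ≤ maxBagSize
  bag≤maxBagSize = tabulate⁻ (xs≤max 0 (tabulate (λ q → ∣ bag D q ∣)))

  maxBagSize-square-bound : ∀ c → WidthSqBound D c n → maxBagSize * maxBagSize ≤ suc (c + c) * suc (c + c) * n
  maxBagSize-square-bound c width =
    argmax-all id {P = λ b → b * b ≤ suc (c + c) * suc (c + c) * n} z≤n
      (tabulate⁺ (λ q → bag-size-bound c n _ (∣p∣≤n (bag D q)) (width q)))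

module Algorithm {n m : ℕ} {G : Graph n} (D : TreeDecomposition G m) (π : ProcessingOrder D) where

  T : RootedTree m
  T = tree D

  -- StrongRegion G S (Y D q) is, by definition, ¬ Resolved S q.
  Resolved : Subset n → Fin m → Set
  Resolved S q = ∀ v → Y D q v → 𝒫 G ((_∈ S) ∪ₚ nbr G (Y D q)) v

  resolved? : ∀ S q → Dec (Resolved S q)
  resolved? S q = all? (λ v → Y? D q v →-dec 𝒫? G (λ u → (u ∈? S) ⊎-dec nbr? G (Y? D q) u) v)

  Resolved-mono : ∀ {S S′ q} → S ⊆ S′ → Resolved S q → Resolved S′ q
  Resolved-mono S⊆S′ res v y = 𝒫-mono G [ inj₁ ∘ S⊆S′ , inj₂ ]′ (res v y)

  Run-exists : ∀ qs S → ∃[ S′ ] Run D qs S S′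
  Run-exists []       S = S , done
  Run-exists (q ∷ qs) S with resolved? S q
  ... | yes res = Product.map₂ (skip (λ strong → strong res)) (Run-exists qs S)
  ... | no  str = Product.map₂ (take str) (Run-exists qs (S ∪ bag D q))

  Run-induction :
    (I : List (Fin m) → Subset n → Set) →
    (∀ {xs q S} → ¬ StrongRegion G S (Y D q) → I xs S → I (xs ++ q ∷ []) S) →
    (∀ {xs q ys S} → nodes π ≡ xs ++ q ∷ ys → StrongRegion G S (Y D q) →
                     I xs S → I (xs ++ q ∷ []) (S ∪ bag D q)) →
    ∀ {S} → AlgOutput D π S → I [] ⊥ → I (nodes π) S
  Run-induction I skip-step take-step out = run out refl
    where
    advance : ∀ {xs q qs} → nodes π ≡ xs ++ q ∷ qs → nodes π ≡ (xs ++ q ∷ []) ++ qs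
    advance {xs} {q} {qs} eq = trans eq (≡-sym (++-assoc xs (q ∷ []) qs))
    run : ∀ {xs qs S S′} → Run D qs S S′ → nodes π ≡ xs ++ qs → I xs S → I (nodes π) S′
    run {xs} done         eq i = subst (λ zs → I zs _) (≡-sym (trans eq (++-identityʳ xs))) i
    run      (skip ¬st r) eq i = run r (advance eq) (skip-step ¬st i)
    run      (take st r)  eq i = run r (advance eq) (take-step eq st i)

  ∈-nodes : ∀ q → q ∈ₗ nodes π
  ∈-nodes q = ∈-resp-↭ (↭-sym (perm π)) (∈-allFin q)

  children-first : ∀ {xs q ys c} → nodes π ≡ xs ++ q ∷ ys → Child T c q → c ∈ₗ xs
  children-first {xs} {ys = ys} {c} eq (c≢r , refl) with ∈-++⁻ xs (subst (c ∈ₗ_) eq (∈-nodes c))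
  ... | inj₁ c∈xs  = c∈xs
  ... | inj₂ c∈q∷ys = ⊥-elim (1+n≰n (subst (_≤ depth T (parent T c)) (depth-par T c c≢r) (not-deeper c∈q∷ys)))
    where
    not-deeper : c ∈ₗ parent T c ∷ ys → depth T c ≤ depth T (parent T c)
    not-deeper (here c≡q) = subst (λ z → depth T z ≤ depth T (parent T c)) (≡-sym c≡q) ≤-refl
    not-deeper (there c∈ys) = ordered π xs (parent T c) c ys eq c∈ys

  Y⊆𝒫-after-take : ∀ {xs q ys S} → nodes π ≡ xs ++ q ∷ ys → All (Resolved S) xs →
                   Y D q ⊆ₚ 𝒫 G (_∈ (S ∪ bag D q))
  Y⊆𝒫-after-take {q = q} {S = S} eq res (q′ , q≤q′ , v∈X) with Desc-split T q≤q′
  ... | inj₁ refl = rule1-self (q⊆p∪q S (bag D q) v∈X)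
  ... | inj₂ (c , c-child , c≤q′) =
    𝒫-elim-nbr G (Y? D c) (p⊆p∪q (bag D q)) border⊆ (All.lookup res (children-first eq c-child) _ y) (inj₁ y)
    where
    y = (q′ , c≤q′ , v∈X)
    border⊆ : border G (Y D c) ⊆ₚ (_∈ (S ∪ bag D q))
    border⊆ b = q⊆p∪q S (bag D q) (subst (λ p → _ ∈ bag D p) (proj₂ c-child) (proj₂ (border-Y⊆bags D c b)))

  progress-skip : ∀ {xs q S} → ¬ StrongRegion G S (Y D q) → All (Resolved S) xs → All (Resolved S) (xs ++ q ∷ [])
  progress-skip {q = q} {S} ¬strong res = ++⁺ res (decidable-stable (resolved? S q) ¬strong ∷ [])

  progress-take : ∀ {xs q ys S} → nodes π ≡ xs ++ q ∷ ys → All (Resolved S) xs →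
                  All (Resolved (S ∪ bag D q)) (xs ++ q ∷ [])
  progress-take {q = q} eq res =
    ++⁺ (All.map (Resolved-mono (p⊆p∪q (bag D q))) res) ((λ _ y → 𝒫-mono G inj₁ (Y⊆𝒫-after-take eq res y)) ∷ [])

  output-resolved : ∀ {S} → AlgOutput D π S → All (Resolved S) (nodes π)
  output-resolved out = Run-induction (λ xs S → All (Resolved S) xs) progress-skip (λ eq _ → progress-take eq) out []

  output-power-dominates : ∀ {S} → AlgOutput D π S → PowerDominates G S
  output-power-dominates {S} out v =
    𝒫-mono G observer∈S (All.lookup (output-resolved out) (∈-nodes (root T)) v (Y-root D v))
    where
    observer∈S : ((_∈ S) ∪ₚ nbr G (Y D (root T))) ⊆ₚ (_∈ S)
    observer∈S (inj₁ u∈S)       = u∈S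
    observer∈S (inj₂ (u∉Y , _)) = ⊥-elim (u∉Y (Y-root D _))

  ⋃Y : List (Fin m) → Fin n → Set
  ⋃Y ts v = Any (λ t → Y D t v) ts

  Settled : Subset n → Fin m → Set
  Settled S t = Y D t ⊆ₚ 𝒫 G (_∈ S) × border G (Y D t) ⊆ₚ (_∈ S)

  Settled-mono : ∀ {S S′ t} → S ⊆ S′ → Settled S t → Settled S′ t
  Settled-mono S⊆S′ (Y⊆𝒫 , border⊆S) = 𝒫-mono G S⊆S′ ∘ Y⊆𝒫 , S⊆S′ ∘ border⊆S

  ⋃Y⊆𝒫 : ∀ {S ts} → All (Settled S) ts → ⋃Y ts ⊆ₚ 𝒫 G (_∈ S)
  ⋃Y⊆𝒫 (st ∷ _)   (here y)  = proj₁ st y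
  ⋃Y⊆𝒫 (_  ∷ sts) (there y) = ⋃Y⊆𝒫 sts y

  border-⋃Y⊆ : ∀ {S ts} → All (Settled S) ts → border G (⋃Y ts) ⊆ₚ (_∈ S)
  border-⋃Y⊆ (st ∷ _)   (here y  , w , e , w∉) = proj₂ st (y , w , e , w∉ ∘ here)
  border-⋃Y⊆ (_  ∷ sts) (there y , w , e , w∉) = border-⋃Y⊆ sts (y , w , e , w∉ ∘ there)

  module Charging (S* : Subset n) (S*-dominates : PowerDominates G S*) (B : ℕ) (bag≤B : ∀ q → ∣ bag D q ∣ ≤ B) where

    record Charged (S : Subset n) : Set where
      field
        taken        : List (Fin m)
        settled      : All (Settled S) taken
        witnesses    : Subset n
        witnesses⊆S* : witnesses ⊆ S*
        witnesses⊆⋃Y : (_∈ witnesses) ⊆ₚ ⋃Y taken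
        size         : ∣ S ∣ ≤ B * ∣ witnesses ∣

    charged-∅ : Charged ⊥
    charged-∅ = record
      { taken = [] ; settled = [] ; witnesses = ⊥
      ; witnesses⊆S* = ⊥-elim ∘ ∉⊥ ; witnesses⊆⋃Y = ⊥-elim ∘ ∉⊥
      ; size = subst (λ z → z ≤ B * z) (≡-sym (∣⊥∣≡0 n)) z≤n }

    charged-take : ∀ {xs q ys S} → nodes π ≡ xs ++ q ∷ ys → All (Resolved S) xs →
                   StrongRegion G S (Y D q) → Charged S → Charged (S ∪ bag D q)
    charged-take {q = q} {S = S} eq res strong ch =
      charge (strongRegion-meets-dominator G (Y? D q) (λ v → Any.any? (λ t → Y? D t v) taken)
                S*-dominates (⋃Y⊆𝒫 settled) (border-⋃Y⊆ settled) strong)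
      where
      open Charged ch
      charge : ∃[ s ] (s ∈ S* × Y D q s × ¬ ⋃Y taken s) → Charged (S ∪ bag D q)
      charge (s , s∈S* , s∈Y , s∉⋃Y) = record
        { taken        = q ∷ taken
        ; settled      = (Y⊆𝒫-after-take eq res , q⊆p∪q S (bag D q) ∘ proj₁ ∘ border-Y⊆bags D q)
                         ∷ All.map (Settled-mono (p⊆p∪q (bag D q))) settled
        ; witnesses    = witnesses ∪ ⁅ s ⁆
        ; witnesses⊆S* = λ v∈ → [ witnesses⊆S* , (λ { refl → s∈S* }) ]′ (y∈p∪⁅x⁆⁻ v∈)
        ; witnesses⊆⋃Y = λ v∈ → [ there ∘ witnesses⊆⋃Y , (λ { refl → here s∈Y }) ]′ (y∈p∪⁅x⁆⁻ v∈)
        ; size         = begin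
            ∣ S ∪ bag D q ∣              ≤⟨ ∣p∪q∣≤∣p∣+∣q∣ S (bag D q) ⟩
            ∣ S ∣ + ∣ bag D q ∣          ≤⟨ +-mono-≤ size (bag≤B q) ⟩
            B * ∣ witnesses ∣ + B        ≡⟨ +-comm (B * ∣ witnesses ∣) B ⟩
            B + B * ∣ witnesses ∣        ≡⟨ ≡-sym (*-suc B ∣ witnesses ∣) ⟩
            B * suc ∣ witnesses ∣        ≤⟨ *-monoʳ-≤ B (∣p∣<∣p∪⁅x⁆∣ (s∉⋃Y ∘ witnesses⊆⋃Y)) ⟩
            B * ∣ witnesses ∪ ⁅ s ⁆ ∣    ∎
        }
        where open ≤-Reasoning

    output-charged : ∀ {S} → AlgOutput D π S → Charged S
    output-charged out =
      proj₂ (Run-induction (λ xs S → All (Resolved S) xs × Charged S)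
               (λ ¬strong → Product.map₁ (progress-skip ¬strong))
               (λ eq strong (res , ch) → progress-take eq res , charged-take eq res strong ch)
               out ([] , charged-∅))

  output-size : ∀ {S S* B} → PowerDominates G S* → (∀ q → ∣ bag D q ∣ ≤ B) →
                AlgOutput D π S → ∣ S ∣ ≤ B * ∣ S* ∣
  output-size {S* = S*} {B} dominates bag≤B out =
    ≤-trans size (*-monoʳ-≤ B (p⊆q⇒∣p∣≤∣q∣ witnesses⊆S*))
    where
    open Charging S* dominates B bag≤B
    open Charged (output-charged out)

theorem4 : ∀ (c : ℕ) → ∃[ C ] (∀ (n : ℕ) (G : Graph n) → Planar G →
             ∀ (m : ℕ) (D : TreeDecomposition G m) → WidthSqBound D c n →
             ∀ (π : ProcessingOrder D) →
               (∃[ S ] AlgOutput D π S) ×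
               (∀ S → AlgOutput D π S →
                  PowerDominates G S ×
                  (∀ (S* : Subset n) → PowerDominates G S* →
                     ∣ S ∣ * ∣ S ∣ ≤ C * C * n * (∣ S* ∣ * ∣ S* ∣))))
theorem4 c = suc (c + c) , λ n G _ m D width π →
  let open Algorithm D π in
  Run-exists (nodes π) ⊥ ,
  λ S out → output-power-dominates out ,
            λ S* dominates → square-≤ {b = maxBagSize D} (output-size dominates (bag≤maxBagSize D) out)
                                                         (maxBagSize-square-bound D c width)
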